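{- For all formulas $\phi,\psi$ of $\mathcal{L}(\Delta)$, the formula $\Delta\phi\land\Delta\psi\to\Delta(\phi\land\psi)$ is valid on the class of quasi-filter neighborhood frames.
   Context: $\mathcal{L}(\Delta)$: $\phi::=p\mid\neg\phi\mid\phi\land\phi\mid\Delta\phi$, $p$ in a countable set $\mathbf{P}$ of variables. A neighborhood model is $\mathcal{M}=\langle S,N,V\rangle$ with $S\neq\emptyset$, $N:S\to\mathcal{P}(\mathcal{P}(S))$, $V:\mathbf{P}\to\mathcal{P}(S)$. Truth: $\mathcal{M},s\vDash p$ iff $s\in V(p)$; Boolean clauses as usual; $\mathcal{M},s\vDash\Delta\phi$ iff $\phi^{\mathcal{M}}\in N(s)$ or $S\setminus\phi^{\mathcal{M}}\in N(s)$, with $\phi^{\mathcal{M}}$ the truth set of $\phi$. A frame $\langle S,N\rangle$ is a quasi-filter if for every $s\in S$: $X,Y\in N(s)$ implies $X\cap Y\in N(s)$, and $X\in N(s)$, $X\subseteq Y\subseteq S$ imply $Y\in N(s)$. Valid on a class of frames: true at every state of every model based on a frame of the class. -}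

module Defs where

open import Data.Nat using (ℕ)
open import Data.Product using (_×_)
open import Relation.Nullary using (¬_)
open import Data.Sum using (_⊎_)

data Form : Set where
  var : ℕ → Form
  ¬'_ : Form → Form
  _∧'_ : Form → Form → Form
  Δ : Form → Form

_⇒'_ : Form → Form → Form
φ ⇒' ψ = ¬' (φ ∧' (¬' ψ))

Subset : Set → Set₁
Subset S = S → Set

_⊆_ : {S : Set} → Subset S → Subset S → Set
X ⊆ Y = ∀ s → X s → Y s

_∩_ : {S : Set} → Subset S → Subset S → Subset S
(X ∩ Y) s = X s × Y s

compl : {S : Set} → Subset S → Subset S
compl X s = ¬ X s

-- Neighborhood frame ⟨S, N⟩ with S nonempty (a designated element).
record Frame : Set₂ where
  field
    S   : Set
    inh : S
    N   : S → Subset S → Set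

open Frame public

Valuation : Frame → Set₁
Valuation F = ℕ → Subset (S F)

truth : (F : Frame) → Valuation F → Form → Subset (S F)
truth F V (var p) s = V p s
truth F V (¬' φ) s = ¬ truth F V φ s
truth F V (φ ∧' ψ) s = truth F V φ s × truth F V ψ s
truth F V (Δ φ) s = N F s (truth F V φ) ⊎ N F s (compl (truth F V φ))

IsQuasiFilter : Frame → Set₁
IsQuasiFilter F =
  (∀ s (X Y : Subset (S F)) → N F s X → N F s Y → N F s (X ∩ Y)) ×
  (∀ s (X Y : Subset (S F)) → N F s X → X ⊆ Y → N F s Y)

ValidOn : Frame → Form → Set₁
ValidOn F φ = (V : Valuation F) (s : S F) → truth F V φ s

-- If both X and Y are neighborhoods, so is X ∩ Y; if the complement of one of
-- them is a neighborhood, then so is the complement of X ∩ Y, since it is a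
-- superset of that complement.
module Submission where

open import Data.Product using (_,_; proj₁; proj₂)
open import Data.Sum using (_⊎_; inj₁; inj₂)
open import Relation.Nullary using (contradiction)

open import Defs

compl-⊆-compl : {S : Set} {X Y : Subset S} → X ⊆ Y → compl Y ⊆ compl X
compl-⊆-compl X⊆Y s ¬Ys Xs = ¬Ys (X⊆Y s Xs)

compl-⊆-compl-∩ˡ : {S : Set} (X Y : Subset S) → compl X ⊆ compl (X ∩ Y)
compl-⊆-compl-∩ˡ X Y = compl-⊆-compl (λ _ → proj₁)

compl-⊆-compl-∩ʳ : {S : Set} (X Y : Subset S) → compl Y ⊆ compl (X ∩ Y)
compl-⊆-compl-∩ʳ X Y = compl-⊆-compl (λ _ → proj₂)

Decides : (F : Frame) → S F → Subset (S F) → Set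
Decides F s X = N F s X ⊎ N F s (compl X)

decides-∩ : (F : Frame) → IsQuasiFilter F → ∀ s (X Y : Subset (S F)) →
            Decides F s X → Decides F s Y → Decides F s (X ∩ Y)
decides-∩ F (∩-closed , ⊆-closed) s X Y (inj₁ NX) (inj₁ NY) =
  inj₁ (∩-closed s X Y NX NY)
decides-∩ F (∩-closed , ⊆-closed) s X Y (inj₂ N∁X) _ =
  inj₂ (⊆-closed s (compl X) (compl (X ∩ Y)) N∁X (compl-⊆-compl-∩ˡ X Y))
decides-∩ F (∩-closed , ⊆-closed) s X Y (inj₁ _) (inj₂ N∁Y) =
  inj₂ (⊆-closed s (compl Y) (compl (X ∩ Y)) N∁Y (compl-⊆-compl-∩ʳ X Y))

mainTheorem9 : (φ ψ : Form) (F : Frame) → IsQuasiFilter F →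
               ValidOn F (((Δ φ) ∧' (Δ ψ)) ⇒' (Δ (φ ∧' ψ)))
mainTheorem9 φ ψ F quasiFilter V s ((Δφ , Δψ) , ¬Δφ∧ψ) =
  contradiction (decides-∩ F quasiFilter s (truth F V φ) (truth F V ψ) Δφ Δψ) ¬Δφ∧ψ
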